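{- Let $q$ be a power of a prime $p$, $B\in\mathrm{SL}_2(\mathbb{F}_q)$ and $n>4$ an integer. For $C\in \mathrm{SL}_2(\mathbb{F}_q)$ and $k\ge1$ let $u_{k,q}^{C}$ be the number of $k$-tuples $(a_1,\ldots,a_k)\in\mathbb{F}_q^k$ with $M_k(a_1,\ldots,a_k)=C$. Then \[ u_{n,q}^{B} = (q-1)\bigl(u_{n-1,q}^{B}-q\, u_{n-3,q}^{ -B}\bigr) + q\, u_{n-2,q}^{ -B} + q\bigl(u_{n-2,q}^{B}-q\, u_{n-4,q}^{ -B}\bigr). \]
   Context: For $a$ in a commutative ring, $M_1(a)=\begin{pmatrix} a&-1\\ 1&0\end{pmatrix}$, and $M_k(a_1,\ldots,a_k)=M_1(a_k)M_1(a_{k-1})\cdots M_1(a_1)$. -}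

module Defs where

open import Level using (Level; _⊔_) renaming (suc to lsuc)
open import Algebra.Bundles using (CommutativeRing)
open import Data.Nat using (ℕ; zero; suc)
open import Data.List using (List; []; _∷_; length; map; concatMap; filter)
open import Data.List.Relation.Unary.Any using (Any)
open import Data.List.Relation.Unary.AllPairs using (AllPairs)
open import Data.Vec using (Vec; []; _∷_)
open import Data.Product using (Σ; _×_; _,_)
open import Relation.Nullary using (¬_; Dec; yes; no)
open import Relation.Binary using (Decidable)

record FiniteField (c ℓ : Level) : Set (lsuc (c ⊔ ℓ)) where
  field
    cring : CommutativeRing c ℓ
  open CommutativeRing cring public
  field
    _≟_      : Decidable _≈_
    1≉0      : ¬ (1# ≈ 0#)
    inverse  : ∀ x → ¬ (x ≈ 0#) → Σ Carrier (λ y → (x * y) ≈ 1#)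
    elems    : List Carrier
    complete : ∀ x → Any (x ≈_) elems
    distinct : AllPairs (λ x y → ¬ (x ≈ y)) elems

  size : ℕ
  size = length elems

  record Mat : Set c where
    pattern
    constructor mat
    field
      m11 m12 m21 m22 : Carrier

  open Mat public

  _·_ : Mat → Mat → Mat
  mat a b c' d · mat e f g h =
    mat (a * e + b * g) (a * f + b * h) (c' * e + d * g) (c' * f + d * h)

  _≈M_ : Mat → Mat → Set ℓ
  A ≈M B = (m11 A ≈ m11 B) × (m12 A ≈ m12 B) × (m21 A ≈ m21 B) × (m22 A ≈ m22 B)

  _≟M_ : (A B : Mat) → Dec (A ≈M B)
  A ≟M B with m11 A ≟ m11 B | m12 A ≟ m12 B | m21 A ≟ m21 B | m22 A ≟ m22 B
  ... | yes p | yes q | yes r | yes s = yes (p , q , r , s)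
  ... | no ¬p | _ | _ | _ = no λ { (p , _ , _ , _) → ¬p p }
  ... | yes _ | no ¬q | _ | _ = no λ { (_ , q , _ , _) → ¬q q }
  ... | yes _ | yes _ | no ¬r | _ = no λ { (_ , _ , r , _) → ¬r r }
  ... | yes _ | yes _ | yes _ | no ¬s = no λ { (_ , _ , _ , s) → ¬s s }

  idM : Mat
  idM = mat 1# 0# 0# 1#

  negM : Mat → Mat
  negM (mat a b c' d) = mat (- a) (- b) (- c') (- d)

  det : Mat → Carrier
  det (mat a b c' d) = a * d - b * c'

  InSL2 : Mat → Set ℓ
  InSL2 A = det A ≈ 1#

  M1 : Carrier → Mat
  M1 a = mat a (- 1#) 1# 0#

  Mk : ∀ {k} → Vec Carrier k → Mat
  Mk []       = idM
  Mk (a ∷ as) = Mk as · M1 a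

  tuples : (k : ℕ) → List (Vec Carrier k)
  tuples zero    = [] ∷ []
  tuples (suc k) = concatMap (λ a → map (a ∷_) (tuples k)) elems

  u : ℕ → Mat → ℕ
  u k C = length (filter (λ as → Mk as ≟M C) (tuples k))

module Submission where

-- Write M_k(a₁,…,a_k) = M · M₁(a₁) with M = M_{k-1}(a₂,…,a_k); its columns are M(a₁,1)ᵀ
-- and −Me₁.  Let G_k(t) count the k-tuples whose product has first column t and, for a tuple
-- with product M, put ρ = M⁻¹t.  As M is invertible, M(a₁,1)ᵀ = t iff (a₁,1) = ρ, so
-- G_{k+1}(t) = Y_k(1), where Y_k(γ) counts the k-tuples with ρ₂ = γ.  Likewise M_k = B forces
-- Me₁ = −Be₂ and then fixes a₁ (det B = 1 makes the remaining condition automatic), so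
-- u_{k+1}(B) = G_k(−Be₂).  Prepending a₁ turns ρ₂ into a₁ρ₂ − ρ₁, an affine function of a₁,
-- and counting the roots of affine maps over F_q gives
--   Y_{k+1}(γ) + Y_k(0) = q^k + q · #{tuples with ρ = (−γ,0)}.
-- Here ρ = (−1,0) says that the first column is −t, and ρ = (0,0) says t = 0.  Hence, for t ≠ 0,
--   G_{k+2}(t) + Y_k(0) = q^k + q G_k(−t)   and   Y_{k+1}(0) + Y_k(0) = q^k,
-- and three instances of the first and two of the second, at t = −Be₂, eliminate Y.

open import Defs
open import Level using (Level)
open import Algebra.Bundles using (CommutativeRing)
open import Data.Bool.Base using (true; false; if_then_else_)
open import Data.Nat.Base as ℕ using (ℕ; zero; suc; _<_; _∸_; _^_; s≤s)
import Data.Nat.Properties as ℕ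
open import Data.Nat.Primality using (Prime)
open import Data.List.Base as List using (List; []; _∷_; _++_; map; concatMap; filter; length)
open import Data.List.Relation.Unary.Any using (Any; here; there)
open import Data.List.Relation.Unary.All as All using (All; []; _∷_)
open import Data.List.Relation.Unary.All.Properties using (All¬⇒¬Any)
open import Data.List.Relation.Unary.AllPairs using (AllPairs; _∷_)
open import Data.Vec.Base using (Vec; []; _∷_)
open import Data.Product.Base using (_×_; _,_; proj₁; proj₂)
open import Data.Product.Relation.Binary.Pointwise.NonDependent
  using (Pointwise; ×-decidable; ×-setoid)
open import Function.Base using (_∘_)
open import Function.Bundles using (_⇔_; mk⇔; Equivalence)
open import Relation.Binary.Bundles using (Setoid)
open import Relation.Binary.PropositionalEquality as ≡ using (_≡_)
open import Relation.Nullary using (¬_; Dec; does; yes; no)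
open import Relation.Nullary.Decidable using (_×-dec_; dec-true; dec-false; does-⇔)
open import Relation.Unary using (Pred; Decidable)

open Equivalence using (to; from)

private variable
  a p q : Level
  A B : Set a

-- Algebra.Solver.Ring.Simple takes the ring itself as coefficients, but its normaliser
-- decides coefficient equality by evaluating _≟_, which does not compute for an abstract
-- field; integer coefficients do.
module IntegerCoefficientSolver {c ℓ} (R : CommutativeRing c ℓ) where
  open import Data.Integer.Base as ℤ using (ℤ; +_; -[1+_]; _⊖_; sign; ∣_∣)
  import Data.Integer.Properties as ℤ
  open import Data.Sign.Base as Sign using (Sign)
  open import Data.Maybe.Base using (Maybe; just; nothing)
  open import Algebra.Solver.Ring.AlmostCommutativeRing
    using (_-Raw-AlmostCommutative⟶_; fromCommutativeRing)

  open CommutativeRing R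
  open import Relation.Binary.Reasoning.Setoid setoid
  open import Algebra.Properties.Ring ring using (-‿distribˡ-*; -‿distribʳ-*)
  open import Algebra.Properties.AbelianGroup +-abelianGroup
    using (⁻¹-involutive; ε⁻¹≈ε; ⁻¹-∙-comm)
  open import Algebra.Properties.Semiring.Mult semiring using (×-homo-+; ×1-homo-*)
    renaming (_×_ to _×ᵣ_)

  signed : Sign → Carrier → Carrier
  signed Sign.+ x = x
  signed Sign.- x = - x

  signed-cong : ∀ s {x y} → x ≈ y → signed s x ≈ signed s y
  signed-cong Sign.+ x≈y = x≈y
  signed-cong Sign.- x≈y = -‿cong x≈y

  signed-0# : ∀ s → signed s 0# ≈ 0#
  signed-0# Sign.+ = refl
  signed-0# Sign.- = ε⁻¹≈ε

  signed-* : ∀ s t x y → signed (s Sign.* t) (x * y) ≈ signed s x * signed t y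
  signed-* Sign.+ Sign.+ x y = refl
  signed-* Sign.+ Sign.- x y = -‿distribʳ-* x y
  signed-* Sign.- Sign.+ x y = -‿distribˡ-* x y
  signed-* Sign.- Sign.- x y = begin
    x * y         ≈⟨ ⁻¹-involutive (x * y) ⟨
    - - (x * y)   ≈⟨ -‿cong (-‿distribʳ-* x y) ⟩
    - (x * - y)   ≈⟨ -‿distribˡ-* x (- y) ⟩
    - x * - y     ∎

  ⟦_⟧ : ℤ → Carrier
  ⟦ i ⟧ = signed (sign i) (∣ i ∣ ×ᵣ 1#)

  ◃-homo : ∀ s n → ⟦ s ℤ.◃ n ⟧ ≈ signed s (n ×ᵣ 1#)
  ◃-homo s      zero    = sym (signed-0# s)
  ◃-homo Sign.+ (suc n) = refl
  ◃-homo Sign.- (suc n) = refl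

  ⊖-homo : ∀ m n → ⟦ m ⊖ n ⟧ ≈ m ×ᵣ 1# - n ×ᵣ 1#
  ⊖-homo zero    zero    = sym (trans (+-congˡ ε⁻¹≈ε) (+-identityʳ 0#))
  ⊖-homo zero    (suc n) = sym (+-identityˡ _)
  ⊖-homo (suc m) zero    = sym (trans (+-congˡ ε⁻¹≈ε) (+-identityʳ _))
  ⊖-homo (suc m) (suc n) = begin
    ⟦ suc m ⊖ suc n ⟧           ≡⟨ ≡.cong ⟦_⟧ (ℤ.[1+m]⊖[1+n]≡m⊖n m n) ⟩
    ⟦ m ⊖ n ⟧                   ≈⟨ ⊖-homo m n ⟩
    x - y                       ≈⟨ +-congˡ (+-identityˡ (- y)) ⟨
    x + (0# + - y)              ≈⟨ +-congˡ (+-congʳ (-‿inverseʳ 1#)) ⟨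
    x + ((1# - 1#) + - y)       ≈⟨ +-congˡ (+-assoc 1# (- 1#) (- y)) ⟩
    x + (1# + (- 1# + - y))     ≈⟨ +-assoc x 1# _ ⟨
    (x + 1#) + (- 1# + - y)     ≈⟨ +-cong (+-comm x 1#) (⁻¹-∙-comm 1# y) ⟩
    (1# + x) - (1# + y)         ∎
    where
    x = m ×ᵣ 1#
    y = n ×ᵣ 1#

  +-homo : ∀ i j → ⟦ i ℤ.+ j ⟧ ≈ ⟦ i ⟧ + ⟦ j ⟧
  +-homo -[1+ m ] -[1+ n ] = begin
    - (1# + suc (m ℕ.+ n) ×ᵣ 1#)        ≡⟨ ≡.cong (λ k → - (1# + k ×ᵣ 1#)) (ℕ.+-suc m n) ⟨
    - (1# + (m ℕ.+ suc n) ×ᵣ 1#)        ≈⟨ -‿cong (+-congˡ (×-homo-+ 1# m (suc n))) ⟩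
    - (1# + (m ×ᵣ 1# + suc n ×ᵣ 1#))    ≈⟨ -‿cong (+-assoc 1# _ _) ⟨
    - ((1# + m ×ᵣ 1#) + suc n ×ᵣ 1#)    ≈⟨ ⁻¹-∙-comm _ _ ⟨
    - (1# + m ×ᵣ 1#) + - (suc n ×ᵣ 1#)  ∎
  +-homo -[1+ m ] (+ n)    = trans (⊖-homo n (suc m)) (+-comm _ _)
  +-homo (+ m)    -[1+ n ] = ⊖-homo m (suc n)
  +-homo (+ m)    (+ n)    = ×-homo-+ 1# m n

  *-homo : ∀ i j → ⟦ i ℤ.* j ⟧ ≈ ⟦ i ⟧ * ⟦ j ⟧
  *-homo i j = begin
    ⟦ s ℤ.◃ (∣ i ∣ ℕ.* ∣ j ∣) ⟧          ≈⟨ ◃-homo s (∣ i ∣ ℕ.* ∣ j ∣) ⟩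
    signed s ((∣ i ∣ ℕ.* ∣ j ∣) ×ᵣ 1#)   ≈⟨ signed-cong s (×1-homo-* ∣ i ∣ ∣ j ∣) ⟩
    signed s (∣ i ∣ ×ᵣ 1# * ∣ j ∣ ×ᵣ 1#)  ≈⟨ signed-* (sign i) (sign j) _ _ ⟩
    ⟦ i ⟧ * ⟦ j ⟧                        ∎
    where s = sign i Sign.* sign j

  -‿homo : ∀ i → ⟦ ℤ.- i ⟧ ≈ - ⟦ i ⟧
  -‿homo -[1+ n ]  = sym (⁻¹-involutive _)
  -‿homo (+ zero)  = sym ε⁻¹≈ε
  -‿homo (+ suc n) = refl

  homomorphism : ℤ.+-*-rawRing -Raw-AlmostCommutative⟶ fromCommutativeRing R
  homomorphism = record
    { ⟦_⟧ = ⟦_⟧ ; +-homo = +-homo ; *-homo = *-homo ; -‿homo = -‿homo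
    ; 0-homo = refl ; 1-homo = +-identityʳ 1#
    }

  equal? : ∀ i j → Maybe (⟦ i ⟧ ≈ ⟦ j ⟧)
  equal? i j with i ℤ.≟ j
  ... | yes ≡.refl = just refl
  ... | no _       = nothing

  open import Algebra.Solver.Ring ℤ.+-*-rawRing (fromCommutativeRing R) homomorphism equal? public
    using (solve; _:=_; _:+_; _:-_; _:*_; :-_; con)

module ListSums where
  open ≡ using (refl; cong; cong₂)
  open import Data.Nat.Base using (_+_; _*_)
  open import Algebra.Properties.CommutativeSemigroup ℕ.+-commutativeSemigroup
    using (interchange)

  ∑ : List A → (A → ℕ) → ℕ
  ∑ []       f = 0
  ∑ (x ∷ xs) f = f x + ∑ xs f

  syntax ∑ xs (λ x → e) = ∑[ x ∈ xs ] e

  ∑-cong : ∀ {f g : A → ℕ} (xs : List A) → (∀ x → f x ≡ g x) → ∑ xs f ≡ ∑ xs g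
  ∑-cong []       f≗g = refl
  ∑-cong (x ∷ xs) f≗g = cong₂ _+_ (f≗g x) (∑-cong xs f≗g)

  ∑-++ : ∀ (xs ys : List A) f → ∑ (xs ++ ys) f ≡ ∑ xs f + ∑ ys f
  ∑-++ []       ys f = refl
  ∑-++ (x ∷ xs) ys f = ≡.trans (cong (f x +_) (∑-++ xs ys f)) (≡.sym (ℕ.+-assoc (f x) _ _))

  ∑-map : ∀ (g : A → B) xs f → ∑ (map g xs) f ≡ ∑ xs (f ∘ g)
  ∑-map g []       f = refl
  ∑-map g (x ∷ xs) f = cong (f (g x) +_) (∑-map g xs f)

  ∑-concatMap : ∀ (g : A → List B) xs f → ∑ (concatMap g xs) f ≡ ∑[ x ∈ xs ] ∑ (g x) f
  ∑-concatMap g []       f = refl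
  ∑-concatMap g (x ∷ xs) f =
    ≡.trans (∑-++ (g x) (concatMap g xs) f) (cong (∑ (g x) f +_) (∑-concatMap g xs f))

  ∑-+ : ∀ (xs : List A) f g → ∑[ x ∈ xs ] (f x + g x) ≡ ∑ xs f + ∑ xs g
  ∑-+ []       f g = refl
  ∑-+ (x ∷ xs) f g = ≡.trans (cong (f x + g x +_) (∑-+ xs f g)) (interchange (f x) (g x) _ _)

  ∑-const : ∀ (xs : List A) k → ∑[ x ∈ xs ] k ≡ length xs * k
  ∑-const []       k = refl
  ∑-const (x ∷ xs) k = cong (k +_) (∑-const xs k)

  ∑-1 : ∀ (xs : List A) → ∑[ x ∈ xs ] 1 ≡ length xs
  ∑-1 xs = ≡.trans (∑-const xs 1) (ℕ.*-identityʳ (length xs))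

  ∑-*ˡ : ∀ k (xs : List A) f → ∑[ x ∈ xs ] (k * f x) ≡ k * ∑ xs f
  ∑-*ˡ k []       f = ≡.sym (ℕ.*-zeroʳ k)
  ∑-*ˡ k (x ∷ xs) f =
    ≡.trans (cong (k * f x +_) (∑-*ˡ k xs f)) (≡.sym (ℕ.*-distribˡ-+ k (f x) _))

  ∑-comm : ∀ (xs : List A) (ys : List B) (f : A → B → ℕ) →
           ∑[ x ∈ xs ] ∑[ y ∈ ys ] f x y ≡ ∑[ y ∈ ys ] ∑[ x ∈ xs ] f x y
  ∑-comm []       ys f = ≡.sym (≡.trans (∑-const ys 0) (ℕ.*-zeroʳ (length ys)))
  ∑-comm (x ∷ xs) ys f =
    ≡.trans (cong (∑ ys (f x) +_) (∑-comm xs ys f)) (≡.sym (∑-+ ys (f x) _))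

  𝟙 : {P : Set p} → Dec P → ℕ
  𝟙 P? = if does P? then 1 else 0

  𝟙-⇔ : {P : Set p} {Q : Set q} (P? : Dec P) (Q? : Dec Q) → P ⇔ Q → 𝟙 P? ≡ 𝟙 Q?
  𝟙-⇔ P? Q? P⇔Q = cong (if_then 1 else 0) (does-⇔ P⇔Q P? Q?)

  𝟙-yes : {P : Set p} (P? : Dec P) → P → 𝟙 P? ≡ 1
  𝟙-yes P? x = cong (if_then 1 else 0) (dec-true P? x)

  𝟙-no : {P : Set p} (P? : Dec P) → ¬ P → 𝟙 P? ≡ 0
  𝟙-no P? ¬x = cong (if_then 1 else 0) (dec-false P? ¬x)

  count : {P : Pred A p} → Decidable P → List A → ℕ
  count P? xs = ∑[ x ∈ xs ] 𝟙 (P? x)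

  length-filter≡count : {P : Pred A p} (P? : Decidable P) (xs : List A) →
                        length (filter P? xs) ≡ count P? xs
  length-filter≡count P? []       = refl
  length-filter≡count P? (x ∷ xs) with does (P? x)
  ... | true  = cong suc (length-filter≡count P? xs)
  ... | false = length-filter≡count P? xs

  count-⇔ : {P : Pred A p} {Q : Pred A q} (P? : Decidable P) (Q? : Decidable Q) (xs : List A) →
            (∀ x → P x ⇔ Q x) → count P? xs ≡ count Q? xs
  count-⇔ P? Q? xs P⇔Q = ∑-cong xs (λ x → 𝟙-⇔ (P? x) (Q? x) (P⇔Q x))

  count-none : {P : Pred A p} (P? : Decidable P) (xs : List A) → All (¬_ ∘ P) xs → count P? xs ≡ 0
  count-none P? []       []          = refl
  count-none P? (x ∷ xs) (¬px ∷ ¬ps) = cong₂ _+_ (𝟙-no (P? x) ¬px) (count-none P? xs ¬ps)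

  count-const : {P : Pred A p} {Q : Set q} (P? : Decidable P) (Q? : Dec Q) (xs : List A) →
                (∀ x → P x ⇔ Q) → count P? xs ≡ length xs * 𝟙 Q?
  count-const P? Q? xs P⇔Q =
    ≡.trans (∑-cong xs (λ x → 𝟙-⇔ (P? x) Q? (P⇔Q x))) (∑-const xs (𝟙 Q?))

  module _ {c ℓ} (S : Setoid c ℓ) where
    open Setoid S renaming (Carrier to X)

    count-unique : {P : Pred X p} (P? : Decidable P) {z : X} (xs : List X) →
                   AllPairs (λ x y → ¬ x ≈ y) xs → Any (z ≈_) xs →
                   (∀ x → P x ⇔ x ≈ z) → count P? xs ≡ 1
    count-unique {P = P} P? (x ∷ xs) (x≉xs ∷ _) (here z≈x) P⇔≈z =
      cong₂ _+_ (𝟙-yes (P? x) (from (P⇔≈z x) (sym z≈x))) (count-none P? xs (All.map ¬P x≉xs))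
      where
      ¬P : ∀ {y} → ¬ x ≈ y → ¬ P y
      ¬P x≉y Py = x≉y (trans (sym z≈x) (sym (to (P⇔≈z _) Py)))
    count-unique {P = P} P? (x ∷ xs) (x≉xs ∷ distinct) (there z∈xs) P⇔≈z =
      cong₂ _+_ (𝟙-no (P? x) x∉) (count-unique P? xs distinct z∈xs P⇔≈z)
      where
      x∉ : ¬ P x
      x∉ Px = All¬⇒¬Any (All.map (λ x≉y z≈y → x≉y (trans (to (P⇔≈z x) Px) z≈y)) x≉xs)
                        z∈xs

open ListSums

module FieldCounting {c ℓ} (F : FiniteField c ℓ) where
  open FiniteField F
  open IntegerCoefficientSolver cring
  open import Data.Integer.Base using (0ℤ)
  open import Relation.Binary.Reasoning.Setoid setoid

  count-≈ : {P : Pred Carrier p} (P? : Decidable P) (z : Carrier) →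
            (∀ a → P a ⇔ a ≈ z) → count P? elems ≡ 1
  count-≈ P? z = count-unique setoid P? elems distinct (complete z)

  count-≈× : {P : Pred Carrier p} {Q : Set q} (P? : Decidable P) (Q? : Dec Q) (z : Carrier) →
             (∀ a → P a ⇔ (a ≈ z × Q)) → count P? elems ≡ 𝟙 Q?
  count-≈× P? (yes Q) z P⇔ =
    count-≈ P? z (λ a → mk⇔ (proj₁ ∘ to (P⇔ a)) (λ a≈z → from (P⇔ a) (a≈z , Q)))
  count-≈× P? (no ¬Q) z P⇔ =
    count-none P? elems (All.universal (λ a Pa → ¬Q (proj₂ (to (P⇔ a) Pa))) elems)

  root? : ∀ α β γ → Decidable (λ a → a * α + β ≈ γ)
  root? α β γ a = (a * α + β) ≟ γ

  count-affine : ∀ α β γ → count (root? α β γ) elems ℕ.+ 𝟙 (α ≟ 0#)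
                           ≡ 1 ℕ.+ size ℕ.* 𝟙 ((α ≟ 0#) ×-dec (β ≟ γ))
  count-affine α β γ with α ≟ 0#
  ... | yes α≈0 =
    ≡.trans (ℕ.+-comm _ 1) (≡.cong suc (count-const (root? α β γ) (yes α≈0 ×-dec (β ≟ γ)) elems solution))
    where
    vanish : ∀ a → a * α + β ≈ β
    vanish a = begin
      a * α + β   ≈⟨ +-congʳ (*-congˡ α≈0) ⟩
      a * 0# + β  ≈⟨ solve 2 (λ a β → a :* con 0ℤ :+ β := β) refl a β ⟩
      β           ∎
    solution : ∀ a → (a * α + β ≈ γ) ⇔ (α ≈ 0# × β ≈ γ)
    solution a = mk⇔ (λ e → α≈0 , trans (sym (vanish a)) e) (λ (_ , e) → trans (vanish a) e)
  ... | no α≉0 =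
    ≡.trans (≡.cong (ℕ._+ 0) (count-≈ (root? α β γ) ((γ - β) * α⁻¹) solution))
            (≡.cong suc (≡.sym (ℕ.*-zeroʳ size)))
    where
    α⁻¹ = proj₁ (inverse α α≉0)
    cancel : ∀ x → x * α * α⁻¹ ≈ x
    cancel x = begin
      x * α * α⁻¹    ≈⟨ *-assoc x α α⁻¹ ⟩
      x * (α * α⁻¹)  ≈⟨ *-congˡ (proj₂ (inverse α α≉0)) ⟩
      x * 1#         ≈⟨ *-identityʳ x ⟩
      x              ∎
    solution : ∀ a → (a * α + β ≈ γ) ⇔ (a ≈ (γ - β) * α⁻¹)
    solution a = mk⇔
      (λ e → begin
        a                       ≈⟨ cancel a ⟨
        a * α * α⁻¹             ≈⟨ *-congʳ (solve 2 (λ x b → x := x :+ b :- b) refl _ β) ⟩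
        (a * α + β - β) * α⁻¹   ≈⟨ *-congʳ (+-congʳ e) ⟩
        (γ - β) * α⁻¹           ∎)
      (λ e → begin
        a * α + β               ≈⟨ +-congʳ (*-congʳ e) ⟩
        (γ - β) * α⁻¹ * α + β   ≈⟨ +-congʳ (*-assoc _ α⁻¹ α) ⟩
        (γ - β) * (α⁻¹ * α) + β ≈⟨ +-congʳ (*-congˡ (*-comm α⁻¹ α)) ⟩
        (γ - β) * (α * α⁻¹) + β ≈⟨ +-congʳ (*-assoc _ α α⁻¹) ⟨
        (γ - β) * α * α⁻¹ + β   ≈⟨ +-congʳ (cancel (γ - β)) ⟩
        γ - β + β               ≈⟨ solve 2 (λ g b → g :- b :+ b := g) refl γ β ⟩
        γ                       ∎)

module LinearAlgebra {c ℓ} (F : FiniteField c ℓ) where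
  open FiniteField F
  open IntegerCoefficientSolver cring
  open import Data.Integer.Base using (0ℤ)
  open import Relation.Binary.Reasoning.Setoid setoid
  open import Algebra.Properties.AbelianGroup +-abelianGroup using (⁻¹-involutive)

  V : Set c
  V = Carrier × Carrier

  infix 4 _≈ᵥ_ _≟ᵥ_
  _≈ᵥ_ : V → V → Set ℓ
  _≈ᵥ_ = Pointwise _≈_ _≈_

  _≟ᵥ_ : (u v : V) → Dec (u ≈ᵥ v)
  _≟ᵥ_ = ×-decidable _≟_ _≟_

  open Setoid (×-setoid setoid setoid) public
    using () renaming (sym to ≈ᵥ-sym; trans to ≈ᵥ-trans)

  0ᵥ : V
  0ᵥ = 0# , 0#

  -ᵥ_ : V → V
  -ᵥ (x , y) = - x , - y

  col₁ col₂ : Mat → V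
  col₁ M = m11 M , m21 M
  col₂ M = m12 M , m22 M

  infixr 7 _·ᵥ_
  _·ᵥ_ : Mat → V → V
  mat a b c' d ·ᵥ (x , y) = a * x + b * y , c' * x + d * y

  adj : Mat → Mat
  adj (mat a b c' d) = mat d (- b) (- c') a

  det-· : ∀ A B → det (A · B) ≈ det A * det B
  det-· (mat a b c' d) (mat e f g h) =
    solve 8 (λ a b c d e f g h →
      (a :* e :+ b :* g) :* (c :* f :+ d :* h) :- (a :* f :+ b :* h) :* (c :* e :+ d :* g)
      := (a :* d :- b :* c) :* (e :* h :- f :* g)) refl a b c' d e f g h

  det-M1 : ∀ a → det (M1 a) ≈ 1#
  det-M1 a = begin
    a * 0# - (- 1#) * 1#  ≈⟨ solve 2 (λ a o → a :* con 0ℤ :- (:- o) :* o := o :* o) refl a 1# ⟩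
    1# * 1#               ≈⟨ *-identityˡ 1# ⟩
    1#                    ∎

  det-Mk : ∀ {k} (as : Vec Carrier k) → InSL2 (Mk as)
  det-Mk []       = begin
    1# * 1# - 0# * 0#  ≈⟨ solve 1 (λ o → o :* o :- con 0ℤ :* con 0ℤ := o :* o) refl 1# ⟩
    1# * 1#            ≈⟨ *-identityˡ 1# ⟩
    1#                 ∎
  det-Mk (a ∷ as) = begin
    det (Mk as · M1 a)        ≈⟨ det-· (Mk as) (M1 a) ⟩
    det (Mk as) * det (M1 a)  ≈⟨ *-cong (det-Mk as) (det-M1 a) ⟩
    1# * 1#                   ≈⟨ *-identityˡ 1# ⟩
    1#                        ∎

  det-negM : ∀ B → det (negM B) ≈ det B
  det-negM (mat a b c' d) =
    solve 4 (λ a b c d → (:- a) :* (:- d) :- (:- b) :* (:- c) := a :* d :- b :* c) refl a b c' d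

  ·ᵥ-cong : ∀ M {u v} → u ≈ᵥ v → M ·ᵥ u ≈ᵥ M ·ᵥ v
  ·ᵥ-cong (mat a b c' d) (x≈x' , y≈y') =
    +-cong (*-congˡ x≈x') (*-congˡ y≈y') , +-cong (*-congˡ x≈x') (*-congˡ y≈y')

  adj-inverseˡ : ∀ M v → InSL2 M → adj M ·ᵥ M ·ᵥ v ≈ᵥ v
  adj-inverseˡ (mat a b c' d) (x , y) detM≈1 =
    trans (solve 6 (λ a b c d x y → d :* (a :* x :+ b :* y) :+ (:- b) :* (c :* x :+ d :* y)
                                    := (a :* d :- b :* c) :* x) refl a b c' d x y) (unit x) ,
    trans (solve 6 (λ a b c d x y → (:- c) :* (a :* x :+ b :* y) :+ a :* (c :* x :+ d :* y)
                                    := (a :* d :- b :* c) :* y) refl a b c' d x y) (unit y)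
    where
    unit : ∀ x → (a * d - b * c') * x ≈ x
    unit x = trans (*-congʳ detM≈1) (*-identityˡ x)

  adj-inverseʳ : ∀ M t → InSL2 M → M ·ᵥ adj M ·ᵥ t ≈ᵥ t
  adj-inverseʳ (mat a b c' d) (x , y) detM≈1 =
    trans (solve 6 (λ a b c d x y → a :* (d :* x :+ (:- b) :* y) :+ b :* ((:- c) :* x :+ a :* y)
                                    := (a :* d :- b :* c) :* x) refl a b c' d x y) (unit x) ,
    trans (solve 6 (λ a b c d x y → c :* (d :* x :+ (:- b) :* y) :+ d :* ((:- c) :* x :+ a :* y)
                                    := (a :* d :- b :* c) :* y) refl a b c' d x y) (unit y)
    where
    unit : ∀ x → (a * d - b * c') * x ≈ x
    unit x = trans (*-congʳ detM≈1) (*-identityˡ x)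

  ·ᵥ≈⇔≈adj·ᵥ : ∀ M {v t} → InSL2 M → (M ·ᵥ v ≈ᵥ t) ⇔ (v ≈ᵥ adj M ·ᵥ t)
  ·ᵥ≈⇔≈adj·ᵥ M {v} {t} detM≈1 = mk⇔
    (λ Mv≈t → ≈ᵥ-trans (≈ᵥ-sym (adj-inverseˡ M v detM≈1)) (·ᵥ-cong (adj M) Mv≈t))
    (λ v≈adjt → ≈ᵥ-trans (·ᵥ-cong M v≈adjt) (adj-inverseʳ M t detM≈1))

  -x≈y⇔x≈-y : ∀ {x y} → (- x ≈ y) ⇔ (x ≈ - y)
  -x≈y⇔x≈-y {x} {y} = mk⇔ (λ -x≈y → trans (sym (⁻¹-involutive x)) (-‿cong -x≈y))
                          (λ x≈-y → trans (-‿cong x≈-y) (⁻¹-involutive y))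

  -ᵥu≈ᵥt⇔u≈ᵥ-ᵥt : ∀ {u t} → (-ᵥ u ≈ᵥ t) ⇔ (u ≈ᵥ -ᵥ t)
  -ᵥu≈ᵥt⇔u≈ᵥ-ᵥt = mk⇔ (λ (e₁ , e₂) → to -x≈y⇔x≈-y e₁ , to -x≈y⇔x≈-y e₂)
                      (λ (e₁ , e₂) → from -x≈y⇔x≈-y e₁ , from -x≈y⇔x≈-y e₂)

  ·ᵥ-neg-e₁ : ∀ M → M ·ᵥ (- 1# , 0#) ≈ᵥ -ᵥ col₁ M
  ·ᵥ-neg-e₁ (mat a b c' d) = negate a b , negate c' d
    where
    negate : ∀ x y → x * - 1# + y * 0# ≈ - x
    negate x y = begin
      x * - 1# + y * 0#  ≈⟨ solve 3 (λ x y o → x :* (:- o) :+ y :* con 0ℤ := :- (x :* o))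
                                    refl x y 1# ⟩
      - (x * 1#)         ≈⟨ -‿cong (*-identityʳ x) ⟩
      - x                ∎

  ·ᵥ-zero : ∀ M → M ·ᵥ (- 0# , 0#) ≈ᵥ 0ᵥ
  ·ᵥ-zero (mat a b c' d) = vanish a b , vanish c' d
    where
    vanish : ∀ x y → x * - 0# + y * 0# ≈ 0#
    vanish = solve 2 (λ x y → x :* (:- con 0ℤ) :+ y :* con 0ℤ := con 0ℤ) refl

  -ᵥcol₂≉0ᵥ : ∀ B → InSL2 B → ¬ (-ᵥ col₂ B ≈ᵥ 0ᵥ)
  -ᵥcol₂≉0ᵥ (mat b₁₁ b₁₂ b₂₁ b₂₂) detB≈1 (-b₁₂≈0 , -b₂₂≈0) = 1≉0 (begin
    1#
      ≈⟨ detB≈1 ⟨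
    b₁₁ * b₂₂ - b₁₂ * b₂₁
      ≈⟨ +-cong (*-congˡ (to -x≈y⇔x≈-y -b₂₂≈0)) (-‿cong (*-congʳ (to -x≈y⇔x≈-y -b₁₂≈0))) ⟩
    b₁₁ * - 0# - - 0# * b₂₁
      ≈⟨ solve 2 (λ a c → a :* (:- con 0ℤ) :- (:- con 0ℤ) :* c := con 0ℤ) refl b₁₁ b₂₁ ⟩
    0#                       ∎)

  col₂-Mk-∷ : ∀ {k} a (as : Vec Carrier k) → col₂ (Mk (a ∷ as)) ≈ᵥ -ᵥ col₁ (Mk as)
  col₂-Mk-∷ a as = ·ᵥ-neg-e₁ (Mk as)

  coords : ∀ {k} → Vec Carrier k → V → V
  coords as t = adj (Mk as) ·ᵥ t

  coords≈ᵥ⇔ : ∀ {k} (as : Vec Carrier k) t v → (coords as t ≈ᵥ v) ⇔ (Mk as ·ᵥ v ≈ᵥ t)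
  coords≈ᵥ⇔ as t v = mk⇔ (λ e → from (·ᵥ≈⇔≈adj·ᵥ (Mk as) (det-Mk as)) (≈ᵥ-sym e))
                         (λ e → ≈ᵥ-sym (to (·ᵥ≈⇔≈adj·ᵥ (Mk as) (det-Mk as)) e))

  coord₂-∷ : ∀ {k} a (as : Vec Carrier k) t →
             proj₂ (coords (a ∷ as) t) ≈ a * proj₂ (coords as t) + - proj₁ (coords as t)
  coord₂-∷ a as (t₁ , t₂) = begin
    - (z * a + w * 1#) * t₁ + (x * a + y * 1#) * t₂
      ≈⟨ +-cong (*-congʳ (-‿cong (+-congˡ (*-identityʳ w))))
                (*-congʳ (+-congˡ (*-identityʳ y))) ⟩
    - (z * a + w) * t₁ + (x * a + y) * t₂
      ≈⟨ solve 7 (λ x y z w a t₁ t₂ →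
                    (:- (z :* a :+ w)) :* t₁ :+ (x :* a :+ y) :* t₂
                    := a :* ((:- z) :* t₁ :+ x :* t₂) :+ :- (w :* t₁ :+ (:- y) :* t₂))
               refl x y z w a t₁ t₂ ⟩
    a * (- z * t₁ + x * t₂) + - (w * t₁ + - y * t₂)
      ∎
    where
    x = m11 (Mk as)
    y = m12 (Mk as)
    z = m21 (Mk as)
    w = m22 (Mk as)

  coord₂-col₁ : ∀ M B → col₁ M ≈ᵥ -ᵥ col₂ B → proj₂ (adj M ·ᵥ col₁ B) ≈ det B
  coord₂-col₁ (mat x y z w) (mat b₁₁ b₁₂ b₂₁ b₂₂) (x≈-b₁₂ , z≈-b₂₂) = begin
    - z * b₁₁ + x * b₂₁
      ≈⟨ +-cong (*-congʳ (-‿cong z≈-b₂₂)) (*-congʳ x≈-b₁₂) ⟩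
    - (- b₂₂) * b₁₁ + - b₁₂ * b₂₁
      ≈⟨ solve 4 (λ a b c d → (:- (:- d)) :* a :+ (:- b) :* c := a :* d :- b :* c)
                 refl b₁₁ b₁₂ b₂₁ b₂₂ ⟩
    b₁₁ * b₂₂ - b₁₂ * b₂₁          ∎

  Mk-∷≈M⇔ : ∀ {k} a (as : Vec Carrier k) B → let ρ = coords as (col₁ B) in
            (Mk (a ∷ as) ≈M B)
            ⇔ (a ≈ proj₁ ρ × (1# ≈ proj₂ ρ × col₁ (Mk as) ≈ᵥ -ᵥ col₂ B))
  Mk-∷≈M⇔ a as B = mk⇔
    (λ (e₁₁ , e₁₂ , e₂₁ , e₂₂) →
       let (a≈ρ₁ , 1≈ρ₂) = to col₁⇔ (e₁₁ , e₂₁) in a≈ρ₁ , 1≈ρ₂ , to col₂⇔ (e₁₂ , e₂₂))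
    (λ (a≈ρ₁ , 1≈ρ₂ , e) → let (e₁₁ , e₂₁) = from col₁⇔ (a≈ρ₁ , 1≈ρ₂)
                               (e₁₂ , e₂₂) = from col₂⇔ e in
                           e₁₁ , e₁₂ , e₂₁ , e₂₂)
    where
    col₁⇔ : (col₁ (Mk (a ∷ as)) ≈ᵥ col₁ B) ⇔ ((a , 1#) ≈ᵥ coords as (col₁ B))
    col₁⇔ = ·ᵥ≈⇔≈adj·ᵥ (Mk as) (det-Mk as)
    col₂⇔ : (col₂ (Mk (a ∷ as)) ≈ᵥ col₂ B) ⇔ (col₁ (Mk as) ≈ᵥ -ᵥ col₂ B)
    col₂⇔ = mk⇔ (λ e → to -ᵥu≈ᵥt⇔u≈ᵥ-ᵥt (≈ᵥ-trans (≈ᵥ-sym (col₂-Mk-∷ a as)) e))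
                (λ e → ≈ᵥ-trans (col₂-Mk-∷ a as) (from -ᵥu≈ᵥt⇔u≈ᵥ-ᵥt e))

module TupleCounting {c ℓ} (F : FiniteField c ℓ) where
  open FiniteField F
  open FieldCounting F
  open LinearAlgebra F
  open ≡.≡-Reasoning

  ∑-tuples : ∀ k (f : Vec Carrier (suc k) → ℕ) →
             ∑ (tuples (suc k)) f ≡ ∑[ as ∈ tuples k ] ∑[ a ∈ elems ] f (a ∷ as)
  ∑-tuples k f = begin
    ∑ (concatMap (λ a → map (a ∷_) (tuples k)) elems) f
      ≡⟨ ∑-concatMap _ elems f ⟩
    ∑[ a ∈ elems ] ∑ (map (a ∷_) (tuples k)) f
      ≡⟨ ∑-cong elems (λ a → ∑-map (a ∷_) (tuples k) f) ⟩
    ∑[ a ∈ elems ] ∑[ as ∈ tuples k ] f (a ∷ as)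
      ≡⟨ ∑-comm elems (tuples k) (λ a as → f (a ∷ as)) ⟩
    ∑[ as ∈ tuples k ] ∑[ a ∈ elems ] f (a ∷ as)
      ∎

  length-tuples : ∀ k → length (tuples k) ≡ size ^ k
  length-tuples zero    = ≡.refl
  length-tuples (suc k) = begin
    length (tuples (suc k))              ≡⟨ ∑-1 (tuples (suc k)) ⟨
    ∑[ as ∈ tuples (suc k) ] 1           ≡⟨ ∑-tuples k (λ _ → 1) ⟩
    ∑[ as ∈ tuples k ] ∑[ a ∈ elems ] 1  ≡⟨ ∑-cong (tuples k) (λ _ → ∑-1 elems) ⟩
    ∑[ as ∈ tuples k ] size              ≡⟨ ∑-const (tuples k) size ⟩
    length (tuples k) ℕ.* size           ≡⟨ ≡.cong (ℕ._* size) (length-tuples k) ⟩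
    size ^ k ℕ.* size                    ≡⟨ ℕ.*-comm (size ^ k) size ⟩
    size ^ suc k                         ∎

  colCount : ℕ → V → ℕ
  colCount k t = count (λ as → col₁ (Mk as) ≟ᵥ t) (tuples k)

  coord₂Count : ℕ → V → Carrier → ℕ
  coord₂Count k t γ = count (λ as → proj₂ (coords as t) ≟ γ) (tuples k)

  coordsCount : ℕ → V → V → ℕ
  coordsCount k t v = count (λ as → coords as t ≟ᵥ v) (tuples k)

  u-suc : ∀ B → InSL2 B → ∀ k → u (suc k) B ≡ colCount k (-ᵥ col₂ B)
  u-suc B detB≈1 k = begin
    u (suc k) B
      ≡⟨ length-filter≡count (λ as → Mk as ≟M B) (tuples (suc k)) ⟩
    count (λ as → Mk as ≟M B) (tuples (suc k))
      ≡⟨ ∑-tuples k _ ⟩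
    ∑[ as ∈ tuples k ] count (λ a → Mk (a ∷ as) ≟M B) elems
      ≡⟨ ∑-cong (tuples k) overFirstEntry ⟩
    colCount k (-ᵥ col₂ B)
      ∎
    where
    overFirstEntry : ∀ (as : Vec Carrier k) →
                     count (λ a → Mk (a ∷ as) ≟M B) elems
                     ≡ 𝟙 (col₁ (Mk as) ≟ᵥ -ᵥ col₂ B)
    overFirstEntry as = begin
      count (λ a → Mk (a ∷ as) ≟M B) elems
        ≡⟨ count-≈× (λ a → Mk (a ∷ as) ≟M B) ((1# ≟ ρ₂) ×-dec column?) ρ₁
                    (λ a → Mk-∷≈M⇔ a as B) ⟩
      𝟙 ((1# ≟ ρ₂) ×-dec column?)
        ≡⟨ 𝟙-⇔ ((1# ≟ ρ₂) ×-dec column?) column? (mk⇔ proj₂ (λ e → 1≈ρ₂ e , e)) ⟩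
      𝟙 column?
        ∎
      where
      ρ₁ = proj₁ (coords as (col₁ B))
      ρ₂ = proj₂ (coords as (col₁ B))
      column? = col₁ (Mk as) ≟ᵥ -ᵥ col₂ B
      1≈ρ₂ : col₁ (Mk as) ≈ᵥ -ᵥ col₂ B → 1# ≈ ρ₂
      1≈ρ₂ e = sym (trans (coord₂-col₁ (Mk as) B e) detB≈1)

  -- Uses that col₁ (Mk (a ∷ as)) is definitionally Mk as ·ᵥ (a , 1#).
  colCount-suc : ∀ k t → colCount (suc k) t ≡ coord₂Count k t 1#
  colCount-suc k t =
    ≡.trans (∑-tuples k (λ as → 𝟙 (col₁ (Mk as) ≟ᵥ t))) (∑-cong (tuples k) overFirstEntry)
    where
    overFirstEntry : ∀ (as : Vec Carrier k) →
                     count (λ a → col₁ (Mk (a ∷ as)) ≟ᵥ t) elems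
                     ≡ 𝟙 (proj₂ (coords as t) ≟ 1#)
    overFirstEntry as = ≡.trans
      (count-≈× (λ a → col₁ (Mk (a ∷ as)) ≟ᵥ t) (1# ≟ ρ₂) (proj₁ (coords as t))
                (λ a → ·ᵥ≈⇔≈adj·ᵥ (Mk as) (det-Mk as)))
      (𝟙-⇔ (1# ≟ ρ₂) (ρ₂ ≟ 1#) (mk⇔ sym sym))
      where ρ₂ = proj₂ (coords as t)

  coord₂Count-suc : ∀ k t γ → coord₂Count (suc k) t γ ℕ.+ coord₂Count k t 0#
                              ≡ size ^ k ℕ.+ size ℕ.* coordsCount k t (- γ , 0#)
  coord₂Count-suc k t γ = begin
    coord₂Count (suc k) t γ ℕ.+ coord₂Count k t 0#
      ≡⟨ ≡.cong (ℕ._+ coord₂Count k t 0#)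
                (∑-tuples k (λ as → 𝟙 (proj₂ (coords as t) ≟ γ))) ⟩
    ∑ (tuples k) roots ℕ.+ coord₂Count k t 0#
      ≡⟨ ∑-+ (tuples k) roots _ ⟨
    ∑[ as ∈ tuples k ] (roots as ℕ.+ 𝟙 (proj₂ (coords as t) ≟ 0#))
      ≡⟨ ∑-cong (tuples k) overFirstEntry ⟩
    ∑[ as ∈ tuples k ] (1 ℕ.+ size ℕ.* 𝟙 (coords as t ≟ᵥ (- γ , 0#)))
      ≡⟨ ∑-+ (tuples k) _ _ ⟩
    ∑[ as ∈ tuples k ] 1 ℕ.+ ∑[ as ∈ tuples k ] (size ℕ.* 𝟙 (coords as t ≟ᵥ (- γ , 0#)))
      ≡⟨ ≡.cong₂ ℕ._+_ (≡.trans (∑-1 (tuples k)) (length-tuples k))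
                       (∑-*ˡ size (tuples k) _) ⟩
    size ^ k ℕ.+ size ℕ.* coordsCount k t (- γ , 0#)
      ∎
    where
    roots : Vec Carrier k → ℕ
    roots as = count (λ a → proj₂ (coords (a ∷ as) t) ≟ γ) elems
    overFirstEntry : ∀ as → roots as ℕ.+ 𝟙 (proj₂ (coords as t) ≟ 0#)
                            ≡ 1 ℕ.+ size ℕ.* 𝟙 (coords as t ≟ᵥ (- γ , 0#))
    overFirstEntry as = begin
      roots as ℕ.+ 𝟙 (ρ₂ ≟ 0#)
        ≡⟨ ≡.cong (ℕ._+ 𝟙 (ρ₂ ≟ 0#))
                  (count-⇔ (λ a → proj₂ (coords (a ∷ as) t) ≟ γ) (root? ρ₂ (- ρ₁) γ)
                           elems affine) ⟩
      count (root? ρ₂ (- ρ₁) γ) elems ℕ.+ 𝟙 (ρ₂ ≟ 0#)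
        ≡⟨ count-affine ρ₂ (- ρ₁) γ ⟩
      1 ℕ.+ size ℕ.* 𝟙 ((ρ₂ ≟ 0#) ×-dec ((- ρ₁) ≟ γ))
        ≡⟨ ≡.cong (λ n → 1 ℕ.+ size ℕ.* n)
                  (𝟙-⇔ ((ρ₂ ≟ 0#) ×-dec ((- ρ₁) ≟ γ)) (coords as t ≟ᵥ (- γ , 0#)) kernel) ⟩
      1 ℕ.+ size ℕ.* 𝟙 (coords as t ≟ᵥ (- γ , 0#))
        ∎
      where
      ρ₁ = proj₁ (coords as t)
      ρ₂ = proj₂ (coords as t)
      affine : ∀ a → (proj₂ (coords (a ∷ as) t) ≈ γ) ⇔ (a * ρ₂ + - ρ₁ ≈ γ)
      affine a = mk⇔ (trans (sym (coord₂-∷ a as t))) (trans (coord₂-∷ a as t))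
      kernel : (ρ₂ ≈ 0# × - ρ₁ ≈ γ) ⇔ (coords as t ≈ᵥ (- γ , 0#))
      kernel = mk⇔ (λ (e₂ , e₁) → to -x≈y⇔x≈-y e₁ , e₂)
                   (λ (e₁ , e₂) → e₂ , from -x≈y⇔x≈-y e₁)

  coordsCount-neg-e₁ : ∀ k t → coordsCount k t (- 1# , 0#) ≡ colCount k (-ᵥ t)
  coordsCount-neg-e₁ k t =
    count-⇔ (λ as → coords as t ≟ᵥ (- 1# , 0#)) (λ as → col₁ (Mk as) ≟ᵥ -ᵥ t)
            (tuples k) firstColumn
    where
    firstColumn : ∀ as → (coords as t ≈ᵥ (- 1# , 0#)) ⇔ (col₁ (Mk as) ≈ᵥ -ᵥ t)
    firstColumn as = mk⇔
      (λ e → to -ᵥu≈ᵥt⇔u≈ᵥ-ᵥt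
               (≈ᵥ-trans (≈ᵥ-sym (·ᵥ-neg-e₁ (Mk as))) (to (coords≈ᵥ⇔ as t _) e)))
      (λ e → from (coords≈ᵥ⇔ as t _)
               (≈ᵥ-trans (·ᵥ-neg-e₁ (Mk as)) (from -ᵥu≈ᵥt⇔u≈ᵥ-ᵥt e)))

  coordsCount-zero : ∀ k t → ¬ (t ≈ᵥ 0ᵥ) → coordsCount k t (- 0# , 0#) ≡ 0
  coordsCount-zero k t t≉0 =
    count-none (λ as → coords as t ≟ᵥ (- 0# , 0#)) (tuples k) (All.universal t≈0 (tuples k))
    where
    t≈0 : ∀ as → ¬ (coords as t ≈ᵥ (- 0# , 0#))
    t≈0 as e = t≉0 (≈ᵥ-trans (≈ᵥ-sym (to (coords≈ᵥ⇔ as t _) e)) (·ᵥ-zero (Mk as)))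

  colCount-rec : ∀ k t → colCount (suc (suc k)) t ℕ.+ coord₂Count k t 0#
                         ≡ size ^ k ℕ.+ size ℕ.* colCount k (-ᵥ t)
  colCount-rec k t = begin
    colCount (suc (suc k)) t ℕ.+ coord₂Count k t 0#
      ≡⟨ ≡.cong (ℕ._+ coord₂Count k t 0#) (colCount-suc (suc k) t) ⟩
    coord₂Count (suc k) t 1# ℕ.+ coord₂Count k t 0#
      ≡⟨ coord₂Count-suc k t 1# ⟩
    size ^ k ℕ.+ size ℕ.* coordsCount k t (- 1# , 0#)
      ≡⟨ ≡.cong (λ n → size ^ k ℕ.+ size ℕ.* n) (coordsCount-neg-e₁ k t) ⟩
    size ^ k ℕ.+ size ℕ.* colCount k (-ᵥ t)
      ∎

  coord₂Count-rec : ∀ k t → ¬ (t ≈ᵥ 0ᵥ) →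
                    coord₂Count (suc k) t 0# ℕ.+ coord₂Count k t 0# ≡ size ^ k
  coord₂Count-rec k t t≉0 = begin
    coord₂Count (suc k) t 0# ℕ.+ coord₂Count k t 0#
      ≡⟨ coord₂Count-suc k t 0# ⟩
    size ^ k ℕ.+ size ℕ.* coordsCount k t (- 0# , 0#)
      ≡⟨ ≡.cong (λ n → size ^ k ℕ.+ size ℕ.* n) (coordsCount-zero k t t≉0) ⟩
    size ^ k ℕ.+ size ℕ.* 0
      ≡⟨ ≡.cong (size ^ k ℕ.+_) (ℕ.*-zeroʳ size) ⟩
    size ^ k ℕ.+ 0
      ≡⟨ ℕ.+-identityʳ (size ^ k) ⟩
    size ^ k
      ∎

  u-rec : ∀ B → InSL2 B → ∀ k →
          u (3 ℕ.+ k) B ℕ.+ coord₂Count k (-ᵥ col₂ B) 0#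
          ≡ size ^ k ℕ.+ size ℕ.* u (suc k) (negM B)
  u-rec B detB≈1 k = begin
    u (3 ℕ.+ k) B ℕ.+ coord₂Count k s 0#
      ≡⟨ ≡.cong (ℕ._+ coord₂Count k s 0#) (u-suc B detB≈1 (2 ℕ.+ k)) ⟩
    colCount (2 ℕ.+ k) s ℕ.+ coord₂Count k s 0#
      ≡⟨ colCount-rec k s ⟩
    size ^ k ℕ.+ size ℕ.* colCount k (-ᵥ s)
      ≡⟨ ≡.cong (λ n → size ^ k ℕ.+ size ℕ.* n) (u-suc (negM B) detN≈1 k) ⟨
    size ^ k ℕ.+ size ℕ.* u (suc k) (negM B)
      ∎
    where
    s = -ᵥ col₂ B
    detN≈1 : InSL2 (negM B)
    detN≈1 = trans (det-negM B) detB≈1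

open ≡ using (refl; cong)
open import Data.Integer using (ℤ; +_; _+_; _-_; _*_)
import Data.Integer.Properties as ℤ
open import Data.Integer.Tactic.RingSolver using (solve; solve-∀)

linear-elimination : ∀ {q Q₀ Q₁ Q₂ g₂ g₃ g₄ h₀ h₁ h₂ z₀ z₁ z₂ : ℤ} →
  Q₁ ≡ q * Q₀ → Q₂ ≡ q * Q₁ → z₁ ≡ Q₀ - z₀ → z₂ ≡ Q₁ - z₁ →
  g₂ ≡ Q₀ + q * h₀ - z₀ → g₃ ≡ Q₁ + q * h₁ - z₁ → g₄ ≡ Q₂ + q * h₂ - z₂ →
  g₄ ≡ (q - + 1) * (g₃ - q * h₁) + q * h₂ + q * (g₂ - q * h₀)
linear-elimination {q} {Q₀} {h₀ = h₀} {h₁} {h₂} {z₀} refl refl refl refl refl refl refl =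
  solve (q List.∷ Q₀ List.∷ h₀ List.∷ h₁ List.∷ h₂ List.∷ z₀ List.∷ List.[])

m+n≡o⇒+m≡+o-+n : ∀ {m n o} → m ℕ.+ n ≡ o → + m ≡ + o - + n
m+n≡o⇒+m≡+o-+n {m} {n} refl =
  ≡.trans (i≡i+j-j (+ m) (+ n)) (cong (_- + n) (≡.sym (ℤ.pos-+ m n)))
  where
  i≡i+j-j : ∀ i j → i ≡ i + j - j
  i≡i+j-j = solve-∀

mainTheorem2 : ∀ {c ℓ} (F : FiniteField c ℓ) (p m : ℕ) → Prime p
    → FiniteField.size F ≡ p ^ m
    → (B : FiniteField.Mat F) → FiniteField.InSL2 F B
    → (n : ℕ) → 4 < n
    → + FiniteField.u F n B
      ≡ (+ FiniteField.size F - + 1)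
          * (+ FiniteField.u F (n ∸ 1) B
             - + FiniteField.size F * + FiniteField.u F (n ∸ 3) (FiniteField.negM F B))
        + + FiniteField.size F * + FiniteField.u F (n ∸ 2) (FiniteField.negM F B)
        + + FiniteField.size F
          * (+ FiniteField.u F (n ∸ 2) B
             - + FiniteField.size F * + FiniteField.u F (n ∸ 4) (FiniteField.negM F B))
mainTheorem2 F _ _ _ _ B detB≈1 (suc (suc (suc (suc (suc k))))) (s≤s (s≤s (s≤s (s≤s (s≤s _))))) =
  linear-elimination {q = + size} (ℤ.pos-* size (size ^ k)) (ℤ.pos-* size (size ^ suc k))
                     (z-rec k) (z-rec (suc k)) (u-recℤ k) (u-recℤ (suc k)) (u-recℤ (suc (suc k)))
  where
  open FiniteField F using (size; u; negM; 0#)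
  open LinearAlgebra F using (-ᵥ_; col₂; -ᵥcol₂≉0ᵥ)
  open TupleCounting F using (coord₂Count; coord₂Count-rec; u-rec)
  s = -ᵥ col₂ B
  z-rec : ∀ j → + coord₂Count (suc j) s 0# ≡ + (size ^ j) - + coord₂Count j s 0#
  z-rec j = m+n≡o⇒+m≡+o-+n (coord₂Count-rec j s (-ᵥcol₂≉0ᵥ B detB≈1))
  u-recℤ : ∀ j → + u (3 ℕ.+ j) B
                 ≡ + (size ^ j) + + size * + u (suc j) (negM B) - + coord₂Count j s 0#
  u-recℤ j = ≡.trans (m+n≡o⇒+m≡+o-+n (u-rec B detB≈1 j))
                     (cong (_- + coord₂Count j s 0#)
                           (≡.trans (ℤ.pos-+ (size ^ j) _)
                                    (cong (λ x → + (size ^ j) + x) (ℤ.pos-* size _))))
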